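{- Let $A$ be a pseudo-hoop. Then for every type III state operator $\mu$ on $A$, the kernel ${\rm Ker}(\mu)=\{x\in A\mid\mu(x)=1\}$ is a normal filter of $A$; that is, every type III state operator on $A$ is compatible.
   Context: A pseudo-hoop is an algebra $(A,\odot,\rightarrow,\rightsquigarrow,1)$ of type $(2,2,2,0)$ such that for all $x,y,z\in A$: $x\odot 1=1\odot x=x$; $x\rightarrow x=x\rightsquigarrow x=1$; $(x\odot y)\rightarrow z=x\rightarrow(y\rightarrow z)$; $(x\odot y)\rightsquigarrow z=y\rightsquigarrow(x\rightsquigarrow z)$; $(x\rightarrow y)\odot x=(y\rightarrow x)\odot y=x\odot(x\rightsquigarrow y)=y\odot(y\rightsquigarrow x)$. The order is $x\le y$ iff $x\rightarrow y=1$; $x\wedge y=(x\rightarrow y)\odot x$. A type III state operator is a map $\mu:A\to A$ such that for all $x,y$: $\mu(x\rightarrow y)=\mu(x)\rightarrow\mu(x\wedge y)$ and $\mu(x\rightsquigarrow y)=\mu(x)\rightsquigarrow\mu(x\wedge y)$; $\mu(x\odot y)=\mu(x)\odot\mu(x\rightsquigarrow x\odot y)=\mu(y\rightarrow x\odot y)\odot\mu(y)$; $\mu(\mu(x)\odot\mu(y))=\mu(x)\odot\mu(y)$; $\mu(\mu(x)\rightarrow\mu(y))=\mu(x)\rightarrow\mu(y)$ and $\mu(\mu(x)\rightsquigarrow\mu(y))=\mu(x)\rightsquigarrow\mu(y)$. A filter is a nonempty $F\subseteq A$ closed under $\odot$ and upward closed; it is normal if for all $x,y$: $x\rightarrow y\in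 F$ iff $x\rightsquigarrow y\in F$. A state operator is compatible if its kernel is a normal filter. -}

module Defs where

open import Level using (Level; suc; _⊔_)
open import Relation.Binary.PropositionalEquality using (_≡_)
open import Data.Product using (_×_; ∃)
open import Function.Bundles using (_⇔_)

record PseudoHoop (a : Level) : Set (suc a) where
  infixl 7 _⊙_
  infixr 5 _⇒_ _⇝_
  field
    Carrier : Set a
    _⊙_ : Carrier → Carrier → Carrier
    _⇒_ : Carrier → Carrier → Carrier
    _⇝_ : Carrier → Carrier → Carrier
    one : Carrier
    ⊙-identityʳ : ∀ x → x ⊙ one ≡ x
    ⊙-identityˡ : ∀ x → one ⊙ x ≡ x
    ⇒-refl : ∀ x → x ⇒ x ≡ one
    ⇝-refl : ∀ x → x ⇝ x ≡ one
    ⊙-⇒ : ∀ x y z → (x ⊙ y) ⇒ z ≡ x ⇒ (y ⇒ z)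
    ⊙-⇝ : ∀ x y z → (x ⊙ y) ⇝ z ≡ y ⇝ (x ⇝ z)
    div₁ : ∀ x y → (x ⇒ y) ⊙ x ≡ (y ⇒ x) ⊙ y
    div₂ : ∀ x y → (y ⇒ x) ⊙ y ≡ x ⊙ (x ⇝ y)
    div₃ : ∀ x y → x ⊙ (x ⇝ y) ≡ y ⊙ (y ⇝ x)

  _≤_ : Carrier → Carrier → Set a
  x ≤ y = x ⇒ y ≡ one

  _∧_ : Carrier → Carrier → Carrier
  x ∧ y = (x ⇒ y) ⊙ x

module _ {a : Level} (A : PseudoHoop a) where
  open PseudoHoop A

  record IsStateOperatorIII (μ : Carrier → Carrier) : Set a where
    field
      μ-⇒ : ∀ x y → μ (x ⇒ y) ≡ μ x ⇒ μ (x ∧ y)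
      μ-⇝ : ∀ x y → μ (x ⇝ y) ≡ μ x ⇝ μ (x ∧ y)
      μ-⊙₁ : ∀ x y → μ (x ⊙ y) ≡ μ x ⊙ μ (x ⇝ x ⊙ y)
      μ-⊙₂ : ∀ x y → μ (x ⊙ y) ≡ μ (y ⇒ x ⊙ y) ⊙ μ y
      μ-μ⊙ : ∀ x y → μ (μ x ⊙ μ y) ≡ μ x ⊙ μ y
      μ-μ⇒ : ∀ x y → μ (μ x ⇒ μ y) ≡ μ x ⇒ μ y
      μ-μ⇝ : ∀ x y → μ (μ x ⇝ μ y) ≡ μ x ⇝ μ y

  record IsFilter {ℓ : Level} (F : Carrier → Set ℓ) : Set (a ⊔ ℓ) where
    field
      nonempty : ∃ F
      ⊙-closed : ∀ {x y} → F x → F y → F (x ⊙ y)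
      up-closed : ∀ {x y} → F x → x ≤ y → F y

  record IsNormalFilter {ℓ : Level} (F : Carrier → Set ℓ) : Set (a ⊔ ℓ) where
    field
      isFilter : IsFilter F
      normal : ∀ x y → F (x ⇒ y) ⇔ F (x ⇝ y)

  Ker : (Carrier → Carrier) → Carrier → Set a
  Ker μ x = μ x ≡ one

  Compatible : (Carrier → Carrier) → Set a
  Compatible μ = IsNormalFilter (Ker μ)

-- In a pseudo-hoop both residuals define the same order: x ⇒ y = 1 iff
-- x ∧ y = x iff x ⇝ y = 1. Since μ(x ⇒ y) = μx ⇒ μ(x ∧ y) and
-- μ(x ⇝ y) = μx ⇝ μ(x ∧ y), normality of Ker μ is exactly this fact applied
-- to μx and μ(x ∧ y). For upward closure, x ≤ y gives x = (y ⇒ x) ⊙ y, so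
-- μx = μ(y ⇒ x) ⊙ μy by the second product axiom, and a product equal to 1
-- has right factor 1. Closure under ⊙ then follows from the first product
-- axiom, because y ≤ x ⇝ x ⊙ y.
module Submission where

open import Level using (Level)
open import Defs
open import Relation.Binary.PropositionalEquality
open import Data.Product using (_,_)
open import Function.Bundles using (_⇔_; mk⇔; Equivalence)

module PseudoHoopProperties {a : Level} (A : PseudoHoop a) where
  open PseudoHoop A

  ⇒-identityˡ : ∀ x → one ⇒ x ≡ x
  ⇒-identityˡ x = begin
    one ⇒ x              ≡⟨ ⊙-identityˡ (one ⇒ x) ⟨
    one ⊙ (one ⇒ x)      ≡⟨ cong (_⊙ (one ⇒ x)) 1⇒x≤x ⟨
    ((one ⇒ x) ⇒ x) ⊙ (one ⇒ x) ≡⟨ div₁ (one ⇒ x) x ⟩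
    (x ⇒ (one ⇒ x)) ⊙ x  ≡⟨ cong (_⊙ x) x≤1⇒x ⟩
    one ⊙ x              ≡⟨ ⊙-identityˡ x ⟩
    x                    ∎
    where
    open ≡-Reasoning
    x≤1⇒x : x ⇒ (one ⇒ x) ≡ one
    x≤1⇒x = trans (sym (⊙-⇒ x one x)) (trans (cong (_⇒ x) (⊙-identityʳ x)) (⇒-refl x))
    1⇒x≤x : (one ⇒ x) ⇒ x ≡ one
    1⇒x≤x = trans (cong (_⇒ x) (sym (⊙-identityʳ (one ⇒ x)))) (trans (⊙-⇒ (one ⇒ x) one x) (⇒-refl (one ⇒ x)))

  ≤-one : ∀ x → x ≤ one
  ≤-one x = begin
    x ⇒ one                    ≡⟨ cong (_⇒ one) x≤1⊙x≡x ⟨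
    ((x ⇒ one) ⊙ x) ⇒ one      ≡⟨ ⊙-⇒ (x ⇒ one) x one ⟩
    (x ⇒ one) ⇒ (x ⇒ one)      ≡⟨ ⇒-refl (x ⇒ one) ⟩
    one                        ∎
    where
    open ≡-Reasoning
    x≤1⊙x≡x : (x ⇒ one) ⊙ x ≡ x
    x≤1⊙x≡x = trans (div₁ x one) (trans (⊙-identityʳ (one ⇒ x)) (⇒-identityˡ x))

  ⊙≡one⇒≡oneʳ : ∀ {x y} → x ⊙ y ≡ one → y ≡ one
  ⊙≡one⇒≡oneʳ {x} {y} xy≡1 = begin
    y                    ≡⟨ ⇒-identityˡ y ⟨
    one ⇒ y              ≡⟨ cong (_⇒ y) xy≡1 ⟨
    (x ⊙ y) ⇒ y          ≡⟨ ⊙-⇒ x y y ⟩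
    x ⇒ (y ⇒ y)          ≡⟨ cong (x ⇒_) (⇒-refl y) ⟩
    x ⇒ one              ≡⟨ ≤-one x ⟩
    one                  ∎
    where open ≡-Reasoning

  ∧-⇝ : ∀ x y → x ∧ y ≡ x ⊙ (x ⇝ y)
  ∧-⇝ x y = trans (div₁ x y) (div₂ x y)

  ≤⇒∧≡ˡ : ∀ {x y} → x ≤ y → x ∧ y ≡ x
  ≤⇒∧≡ˡ {x} x≤y = trans (cong (_⊙ x) x≤y) (⊙-identityˡ x)

  ∧≡ˡ⇒≤ : ∀ {x y} → x ∧ y ≡ x → x ≤ y
  ∧≡ˡ⇒≤ {x} {y} x∧y≡x =
    trans (cong (_⇒ y) (sym x∧y≡x)) (trans (⊙-⇒ (x ⇒ y) x y) (⇒-refl (x ⇒ y)))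

  ⇝≡one⇒∧≡ˡ : ∀ {x y} → x ⇝ y ≡ one → x ∧ y ≡ x
  ⇝≡one⇒∧≡ˡ {x} {y} x⇝y≡1 =
    trans (∧-⇝ x y) (trans (cong (x ⊙_) x⇝y≡1) (⊙-identityʳ x))

  ∧≡ˡ⇒⇝≡one : ∀ {x y} → x ∧ y ≡ x → x ⇝ y ≡ one
  ∧≡ˡ⇒⇝≡one {x} {y} x∧y≡x = begin
    x ⇝ y                      ≡⟨ cong (_⇝ y) (trans (sym x∧y≡x) (∧-⇝ x y)) ⟩
    (x ⊙ (x ⇝ y)) ⇝ y          ≡⟨ ⊙-⇝ x (x ⇝ y) y ⟩
    (x ⇝ y) ⇝ (x ⇝ y)          ≡⟨ ⇝-refl (x ⇝ y) ⟩
    one                        ∎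
    where open ≡-Reasoning

  ≤⇔⇝≡one : ∀ {x y} → x ≤ y ⇔ x ⇝ y ≡ one
  ≤⇔⇝≡one = mk⇔ (λ x≤y → ∧≡ˡ⇒⇝≡one (≤⇒∧≡ˡ x≤y)) (λ x⇝y≡1 → ∧≡ˡ⇒≤ (⇝≡one⇒∧≡ˡ x⇝y≡1))

  ≤-⇝-⊙ : ∀ x y → y ≤ (x ⇝ x ⊙ y)
  ≤-⇝-⊙ x y = Equivalence.from ≤⇔⇝≡one (trans (sym (⊙-⇝ x y (x ⊙ y))) (⇝-refl (x ⊙ y)))

module StateOperatorIIIProperties {a : Level} (A : PseudoHoop a)
  {μ : PseudoHoop.Carrier A → PseudoHoop.Carrier A} (isState : IsStateOperatorIII A μ) where
  open PseudoHoop A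
  open PseudoHoopProperties A
  open IsStateOperatorIII isState

  μ-one : μ one ≡ one
  μ-one = begin
    μ one                ≡⟨ cong μ (⇒-refl (μ one)) ⟨
    μ (μ one ⇒ μ one)    ≡⟨ μ-μ⇒ one one ⟩
    μ one ⇒ μ one        ≡⟨ ⇒-refl (μ one) ⟩
    one                  ∎
    where open ≡-Reasoning

  Ker-up-closed : ∀ {x y} → Ker A μ x → x ≤ y → Ker A μ y
  Ker-up-closed {x} {y} μx≡1 x≤y = ⊙≡one⇒≡oneʳ (begin
    μ (y ⇒ (y ⇒ x) ⊙ y) ⊙ μ y  ≡⟨ μ-⊙₂ (y ⇒ x) y ⟨
    μ ((y ⇒ x) ⊙ y)            ≡⟨ cong μ (trans (sym (≤⇒∧≡ˡ x≤y)) (div₁ x y)) ⟨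
    μ x                        ≡⟨ μx≡1 ⟩
    one                        ∎)
    where open ≡-Reasoning

  Ker-⊙-closed : ∀ {x y} → Ker A μ x → Ker A μ y → Ker A μ (x ⊙ y)
  Ker-⊙-closed {x} {y} μx≡1 μy≡1 = begin
    μ (x ⊙ y)                  ≡⟨ μ-⊙₁ x y ⟩
    μ x ⊙ μ (x ⇝ x ⊙ y)        ≡⟨ cong₂ _⊙_ μx≡1 (Ker-up-closed μy≡1 (≤-⇝-⊙ x y)) ⟩
    one ⊙ one                  ≡⟨ ⊙-identityˡ one ⟩
    one                        ∎
    where open ≡-Reasoning

  Ker-normal : ∀ x y → Ker A μ (x ⇒ y) ⇔ Ker A μ (x ⇝ y)
  Ker-normal x y = mk⇔
    (λ μ[x⇒y]≡1 → trans (μ-⇝ x y) (Equivalence.to ≤⇔⇝≡one (trans (sym (μ-⇒ x y)) μ[x⇒y]≡1)))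
    (λ μ[x⇝y]≡1 → trans (μ-⇒ x y) (Equivalence.from ≤⇔⇝≡one (trans (sym (μ-⇝ x y)) μ[x⇝y]≡1)))

proposition5p15 : {a : Level} (A : PseudoHoop a) (μ : PseudoHoop.Carrier A → PseudoHoop.Carrier A)
    → IsStateOperatorIII A μ → IsNormalFilter A (Ker A μ)
proposition5p15 A μ isState = record
  { isFilter = record
    { nonempty = PseudoHoop.one A , μ-one
    ; ⊙-closed = Ker-⊙-closed
    ; up-closed = Ker-up-closed
    }
  ; normal = Ker-normal
  }
  where open StateOperatorIIIProperties A isState
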